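{- (1) For every $\lambda$-context $c$, $\mathrm{lev}^{v}(c) = \mathrm{lev}(c^{v})$. (2) For all $t,s\in\Lambda_{\mathcal{O}}$ and $k\in\mathbb{N}$: $t\to_{\beta_v:k} s$ iff $t^v \to_{!\beta:k}\cdot\to_{\mathsf{d}:k}^{=} s^v$; and $t\to_{\mathbf{o}:k} s$ iff $t^v\to_{\mathbf{o}:k}\cdot\to_{\mathsf{d}:k}^{=} s^v$, for any $\mathbf{o}\in\mathcal{O}$. (3) For every $t\in\Lambda_{\mathcal{O}}$, $\mathrm{ll}^v(t)=\mathrm{ll}(t^v)$.
   Context: Fix operators $\mathcal{O}$ with arities. $\lambda$-terms $t ::= x\mid\lambda x.t\mid ts\mid\mathbf{o}(t_1,\dots,t_k)$ (set $\Lambda_{\mathcal{O}}$; values = variables and abstractions) and $\lambda$-contexts $c ::= [\cdot]\mid tc\mid ct\mid \lambda x.c\mid \mathbf{o}(t_1,\dots,c,\dots,t_k)$; bang terms $T ::= x\mid\lambda x.T\mid TS\mid !T\mid \mathbf{o}(T_1,\dots,T_k)$ and bang contexts $C ::= [\cdot]\mid\lambda x.C\mid TC\mid CT\mid !C\mid\mathbf{o}(T_1,\dots,C,\dots,T_k)$. Rules: $(\lambda x.t)v\mapsto_{\beta_v} t[v/x]$ ($v$ value), $(\lambda x.T)\,!S\mapsto_{!\beta}T[S/x]$, $(\lambda x.x)\,!T\mapsto_{\mathsf{d}}T$, and for each $\mathbf{o}$ a rule $\mapsto_{\mathbf{o}}$ with left-hand sides of shape $\mathbf{o}(\dots)$;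 on bang terms $\mapsto_{\mathbf{o}}$ is the image under $(\cdot)^v$ of the rule on $\lambda$-terms. CbV translation of terms: $x^v=!x$, $(\lambda x.t)^v=!(\lambda x.t^v)$, $\mathbf{o}(t_1,\dots)^v=\mathbf{o}(t_1^v,\dots)$, $(ts)^v=T\,s^v$ if $t^v=!T$, else $((\lambda x.x)\,t^v)\,s^v$. Of contexts: $[\cdot]^v=[\cdot]$, $(\lambda x.c)^v=!(\lambda x.c^v)$, $\mathbf{o}(t_1,\dots,c,\dots,t_k)^v=\mathbf{o}(t_1^v,\dots,c^v,\dots,t_k^v)$, $(ct)^v=C\,t^v$ if $c^v=!C$, else $((\lambda x.x)\,c^v)\,t^v$; $(tc)^v=T\,c^v$ if $t^v=!T$, else $((\lambda x.x)\,t^v)\,c^v$. Bang level: $\mathrm{lev}([\cdot])=0$, $\mathrm{lev}(\lambda x.C)=\mathrm{lev}(CT)=\mathrm{lev}(TC)=\mathrm{lev}(C)$, $\mathrm{lev}(!C)=\mathrm{lev}(\mathbf{o}(\dots,C,\dots))=\mathrm{lev}(C)+1$. CbV level: $\mathrm{lev}^v([\cdot])=0$, $\mathrm{lev}^v(\lambda x.c)=\mathrm{lev}^v(c)+1$, $\mathrm{lev}^v(ct)=\mathrm{lev}^v(c')$ if $c=\lambda x.c'$ and $\mathrm{lev}^v(c)$ otherwise, $\mathrm{lev}^v(tc)=\mathrm{lev}^v(c)$, $\mathrm{lev}^v(\mathbf{o}(\dots,c,\dots))=\mathrm{lev}^v(c)+1$. A step $C[R]\to_\rho C[R']$ with $R\mapsto_\rho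 R'$ is at level $k$ ($\to_{\rho:k}$) if the level of $C$ is $k$ ($\mathrm{lev}^v$ for $\lambda$-terms, $\mathrm{lev}$ for bang terms); $\to^{=}$ is the reflexive closure, $\cdot$ composition. Least level: $\mathrm{ll}^v(t)=\inf\{\mathrm{lev}^v(c)\mid t=c[r], r\text{ a }\beta_v\text{ - or }\mathbf{o}\text{ -redex}\}$ and $\mathrm{ll}(T)=\inf\{\mathrm{lev}(C)\mid T=C[R], R\text{ a }!\beta\text{ - or }\mathbf{o}\text{ -redex}\}$, in $\mathbb{N}\cup\{\infty\}$. -}

module Defs where

open import Data.Nat using (ℕ; zero; suc; _+_; _≤_)
open import Data.Vec using (Vec; []; _∷_; _++_)
open import Data.Product using (Σ; Σ-syntax; ∃; _×_; _,_)
open import Data.Sum using (_⊎_)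
open import Relation.Binary.PropositionalEquality using (_≡_; subst)

record Sig : Set₁ where
  field
    O  : Set
    ar : O → ℕ
open Sig public

data Term (S : Sig) : Set where
  var : ℕ → Term S
  lam : Term S → Term S
  app : Term S → Term S → Term S
  op  : (o : O S) → Vec (Term S) (ar S o) → Term S

data BTerm (S : Sig) : Set where
  var : ℕ → BTerm S
  lam : BTerm S → BTerm S
  app : BTerm S → BTerm S → BTerm S
  !_  : BTerm S → BTerm S
  op  : (o : O S) → Vec (BTerm S) (ar S o) → BTerm S

-- contexts; opC o e ts c us  is  o(ts , c , us)
data Ctx (S : Sig) : Set where
  hole : Ctx S
  lam  : Ctx S → Ctx S
  appL : Ctx S → Term S → Ctx S
  appR : Term S → Ctx S → Ctx S
  opC  : (o : O S) {n m : ℕ} → n + suc m ≡ ar S o →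
         Vec (Term S) n → Ctx S → Vec (Term S) m → Ctx S

data BCtx (S : Sig) : Set where
  hole : BCtx S
  lam  : BCtx S → BCtx S
  appL : BCtx S → BTerm S → BCtx S
  appR : BTerm S → BCtx S → BCtx S
  bang : BCtx S → BCtx S
  opC  : (o : O S) {n m : ℕ} → n + suc m ≡ ar S o →
         Vec (BTerm S) n → BCtx S → Vec (BTerm S) m → BCtx S

module _ {S : Sig} where

  -- plugging (may capture variables)

  plug : Ctx S → Term S → Term S
  plug hole u = u
  plug (lam c) u = lam (plug c u)
  plug (appL c t) u = app (plug c u) t
  plug (appR t c) u = app t (plug c u)
  plug (opC o e ts c us) u = op o (subst (Vec (Term S)) e (ts ++ (plug c u ∷ us)))

  bplug : BCtx S → BTerm S → BTerm S
  bplug hole u = u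
  bplug (lam c) u = lam (bplug c u)
  bplug (appL c t) u = app (bplug c u) t
  bplug (appR t c) u = app t (bplug c u)
  bplug (bang c) u = ! (bplug c u)
  bplug (opC o e ts c us) u = op o (subst (Vec (BTerm S)) e (ts ++ (bplug c u ∷ us)))

  ext : (ℕ → ℕ) → ℕ → ℕ
  ext ρ zero = zero
  ext ρ (suc n) = suc (ρ n)

  mutual
    ren : (ℕ → ℕ) → Term S → Term S
    ren ρ (var x) = var (ρ x)
    ren ρ (lam t) = lam (ren (ext ρ) t)
    ren ρ (app t s) = app (ren ρ t) (ren ρ s)
    ren ρ (op o ts) = op o (renV ρ ts)

    renV : ∀ {n} → (ℕ → ℕ) → Vec (Term S) n → Vec (Term S) n
    renV ρ [] = []
    renV ρ (t ∷ ts) = ren ρ t ∷ renV ρ ts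

  exts : (ℕ → Term S) → ℕ → Term S
  exts σ zero = var zero
  exts σ (suc n) = ren suc (σ n)

  mutual
    sub : (ℕ → Term S) → Term S → Term S
    sub σ (var x) = σ x
    sub σ (lam t) = lam (sub (exts σ) t)
    sub σ (app t s) = app (sub σ t) (sub σ s)
    sub σ (op o ts) = op o (subV σ ts)

    subV : ∀ {n} → (ℕ → Term S) → Vec (Term S) n → Vec (Term S) n
    subV σ [] = []
    subV σ (t ∷ ts) = sub σ t ∷ subV σ ts

  single : Term S → ℕ → Term S
  single v zero = v
  single v (suc n) = var n

  -- t [ v ]  is  t[v/x] for the variable x bound by the λ (index 0)
  _[_] : Term S → Term S → Term S
  t [ v ] = sub (single v) t

  mutual
    bren : (ℕ → ℕ) → BTerm S → BTerm S
    bren ρ (var x) = var (ρ x)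
    bren ρ (lam t) = lam (bren (ext ρ) t)
    bren ρ (app t s) = app (bren ρ t) (bren ρ s)
    bren ρ (! t) = ! (bren ρ t)
    bren ρ (op o ts) = op o (brenV ρ ts)

    brenV : ∀ {n} → (ℕ → ℕ) → Vec (BTerm S) n → Vec (BTerm S) n
    brenV ρ [] = []
    brenV ρ (t ∷ ts) = bren ρ t ∷ brenV ρ ts

  bexts : (ℕ → BTerm S) → ℕ → BTerm S
  bexts σ zero = var zero
  bexts σ (suc n) = bren suc (σ n)

  mutual
    bsub : (ℕ → BTerm S) → BTerm S → BTerm S
    bsub σ (var x) = σ x
    bsub σ (lam t) = lam (bsub (bexts σ) t)
    bsub σ (app t s) = app (bsub σ t) (bsub σ s)
    bsub σ (! t) = ! (bsub σ t)
    bsub σ (op o ts) = op o (bsubV σ ts)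

    bsubV : ∀ {n} → (ℕ → BTerm S) → Vec (BTerm S) n → Vec (BTerm S) n
    bsubV σ [] = []
    bsubV σ (t ∷ ts) = bsub σ t ∷ bsubV σ ts

  bsingle : BTerm S → ℕ → BTerm S
  bsingle v zero = v
  bsingle v (suc n) = var n

  _⟦_⟧ : BTerm S → BTerm S → BTerm S
  T ⟦ U ⟧ = bsub (bsingle U) T

  Id : BTerm S
  Id = lam (var zero)

  appᵛ : BTerm S → BTerm S → BTerm S
  appᵛ (! T) U = app T U
  appᵛ T U = app (app Id T) U

  mutual
    _ᵛ : Term S → BTerm S
    var x ᵛ = ! var x
    lam t ᵛ = ! lam (t ᵛ)
    app t s ᵛ = appᵛ (t ᵛ) (s ᵛ)
    op o ts ᵛ = op o (ts ᵛs)

    _ᵛs : ∀ {n} → Vec (Term S) n → Vec (BTerm S) n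
    [] ᵛs = []
    (t ∷ ts) ᵛs = (t ᵛ) ∷ (ts ᵛs)

  appLᵛ : BCtx S → BTerm S → BCtx S
  appLᵛ (bang C) T = appL C T
  appLᵛ C T = appL (appR Id C) T

  appRᵛ : BTerm S → BCtx S → BCtx S
  appRᵛ (! T) C = appR T C
  appRᵛ T C = appR (app Id T) C

  _ᶜᵛ : Ctx S → BCtx S
  hole ᶜᵛ = hole
  lam c ᶜᵛ = bang (lam (c ᶜᵛ))
  appL c t ᶜᵛ = appLᵛ (c ᶜᵛ) (t ᵛ)
  appR t c ᶜᵛ = appRᵛ (t ᵛ) (c ᶜᵛ)
  opC o e ts c us ᶜᵛ = opC o e (ts ᵛs) (c ᶜᵛ) (us ᵛs)

  levᵛ : Ctx S → ℕ
  levᵛ hole = 0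
  levᵛ (lam c) = suc (levᵛ c)
  levᵛ (appL (lam c') t) = levᵛ c'
  levᵛ (appL c t) = levᵛ c
  levᵛ (appR t c) = levᵛ c
  levᵛ (opC o e ts c us) = suc (levᵛ c)

  lev : BCtx S → ℕ
  lev hole = 0
  lev (lam C) = lev C
  lev (appL C T) = lev C
  lev (appR T C) = lev C
  lev (bang C) = suc (lev C)
  lev (opC o e ts C us) = suc (lev C)

  data Value : Term S → Set where
    var : ∀ x → Value (var x)
    lam : ∀ t → Value (lam t)

  data βᵥ : Term S → Term S → Set where
    βv : ∀ t v → Value v → βᵥ (app (lam t) v) (t [ v ])

  data !β : BTerm S → BTerm S → Set where
    bβ : ∀ T U → !β (app (lam T) (! U)) (T ⟦ U ⟧)

  data 𝖽 : BTerm S → BTerm S → Set where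
    der : ∀ T → 𝖽 (app (lam (var zero)) (! T)) T

  ORules : Set₁
  ORules = (o : O S) → Term S → Term S → Set

  OShaped : ORules → Set
  OShaped R = ∀ o r r' → R o r r' → Σ[ ts ∈ Vec (Term S) (ar S o) ] r ≡ op o ts

  data BO (R : ORules) (o : O S) : BTerm S → BTerm S → Set where
    img : ∀ r r' → R o r r' → BO R o (r ᵛ) (r' ᵛ)

  StepAtᵛ : (Term S → Term S → Set) → ℕ → Term S → Term S → Set
  StepAtᵛ ρ k t s = Σ[ c ∈ Ctx S ] Σ[ r ∈ Term S ] Σ[ r' ∈ Term S ]
    (ρ r r' × t ≡ plug c r × s ≡ plug c r' × levᵛ c ≡ k)

  StepAt : (BTerm S → BTerm S → Set) → ℕ → BTerm S → BTerm S → Set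
  StepAt ρ k T U = Σ[ C ∈ BCtx S ] Σ[ R ∈ BTerm S ] Σ[ R' ∈ BTerm S ]
    (ρ R R' × T ≡ bplug C R × U ≡ bplug C R' × lev C ≡ k)

_·_ : {A : Set} → (A → A → Set) → (A → A → Set) → A → A → Set
(P · Q) a b = ∃ λ c → P a c × Q c b

data _⁼ {A : Set} (P : A → A → Set) : A → A → Set where
  rfl  : ∀ {a} → (P ⁼) a a
  step : ∀ {a b} → P a b → (P ⁼) a b

data ℕ∞ : Set where
  fin : ℕ → ℕ∞
  ∞   : ℕ∞

data _≤∞_ : ℕ∞ → ℕ∞ → Set where
  fin≤fin : ∀ {m n} → m ≤ n → fin m ≤∞ fin n
  ≤top    : ∀ {x} → x ≤∞ ∞

IsInf : (ℕ → Set) → ℕ∞ → Set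
IsInf A x = (∀ m → A m → x ≤∞ fin m) × (∀ y → (∀ m → A m → y ≤∞ fin m) → y ≤∞ x)

module _ {S : Sig} where

  RedexΛ : ORules {S} → Term S → Set
  RedexΛ R r = (∃ λ r' → βᵥ r r') ⊎ (∃ λ o → ∃ λ r' → R o r r')

  RedexB : ORules {S} → BTerm S → Set
  RedexB R T = (∃ λ T' → !β T T') ⊎ (∃ λ o → ∃ λ T' → BO R o T T')

  llᵛ≡ : ORules {S} → Term S → ℕ∞ → Set
  llᵛ≡ R t = IsInf (λ k → Σ[ c ∈ Ctx S ] Σ[ r ∈ Term S ]
                           (RedexΛ R r × t ≡ plug c r × levᵛ c ≡ k))

  ll≡ : ORules {S} → BTerm S → ℕ∞ → Set
  ll≡ R T = IsInf (λ k → Σ[ C ∈ BCtx S ] Σ[ U ∈ BTerm S ]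
                          (RedexB R U × T ≡ bplug C U × lev C ≡ k))

-- The translation is compositional up to administrative redexes: (c[u])ᵛ is cᶜᵛ[uᵛ], except that a value
-- landing in function position leaves one 𝖽-redex Id (! V), contracted at the level of cᶜᵛ, and cᶜᵛ has the
-- CbV level of c. A βᵥ-redex (λx.t) v translates to the !β-redex (λx.tᵛ) (! V) with contractum (t[v/x])ᵛ, and an
-- o-redex to its image, so steps and redex positions are simulated at the same level. Conversely a
-- redex-shaped subterm of tᵛ sits at a translated position cᶜᵛ and is itself a translation uᵛ, since the
-- translation never creates such shapes. The trailing 𝖽-step is then forced: translations are 𝖽-normal and
-- two 𝖽-redexes never overlap, so at most one 𝖽-step leads from cᶜᵛ[uᵛ] to a 𝖽-normal term.
module Submission where

open import Defs
open import Data.Nat using (ℕ)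
open import Data.Product using (_×_)
open import Relation.Binary.PropositionalEquality using (_≡_)
open import Function.Bundles using (_⇔_)

open import Data.Nat using (zero; suc; _+_)
open import Data.Nat.Properties using (suc-injective)
open import Data.Vec using (Vec; []; _∷_; _++_)
open import Data.Vec.Properties using (∷-injectiveˡ; ∷-injectiveʳ)
open import Data.Vec.Relation.Unary.Any using (here; there)
open import Data.Vec.Membership.Propositional using (_∈_)
open import Data.Vec.Membership.Propositional.Properties using (∈-++⁺ʳ)
open import Data.Product using (Σ; Σ-syntax; ∃; ∃₂; _,_; proj₁)
open import Data.Sum using (_⊎_; inj₁; inj₂)
import Data.Sum as Sum
open import Data.Empty using (⊥; ⊥-elim)
open import Data.Unit using (⊤; tt)
open import Relation.Nullary using (¬_)
open import Relation.Binary.PropositionalEquality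
  using (refl; sym; trans; cong; cong₂; subst; subst₂; _≢_; module ≡-Reasoning)
open import Function.Bundles using (mk⇔; Equivalence)

-- Vectors with a hole

module _ {A : Set} where

  subst-∷ : ∀ {m n} (e : suc m ≡ suc n) {x : A} (xs : Vec A m) →
    subst (Vec A) e (x ∷ xs) ≡ x ∷ subst (Vec A) (suc-injective e) xs
  subst-∷ refl xs = refl

  ∈⇒hole : ∀ {N a} {v : Vec A N} → a ∈ v →
    ∃ λ n → ∃ λ m → Σ (n + suc m ≡ N) λ e →
      ∃₂ λ (xs : Vec A n) (ys : Vec A m) → v ≡ subst (Vec A) e (xs ++ a ∷ ys)
  ∈⇒hole {v = _ ∷ ys} (here refl) = 0 , _ , refl , [] , ys , refl
  ∈⇒hole {v = x ∷ _} (there p) with ∈⇒hole p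
  ... | n , m , refl , xs , ys , refl = suc n , m , refl , x ∷ xs , ys , refl

  hole-split : ∀ {N n₁ m₁ n₂ m₂} (e₁ : n₁ + suc m₁ ≡ N) (e₂ : n₂ + suc m₂ ≡ N)
    (xs₁ : Vec A n₁) a (ys₁ : Vec A m₁) (xs₂ : Vec A n₂) b (ys₂ : Vec A m₂) →
    subst (Vec A) e₁ (xs₁ ++ a ∷ ys₁) ≡ subst (Vec A) e₂ (xs₂ ++ b ∷ ys₂) →
    (a ≡ b × ∀ c → subst (Vec A) e₁ (xs₁ ++ c ∷ ys₁) ≡ subst (Vec A) e₂ (xs₂ ++ c ∷ ys₂))
    ⊎ (∀ c → a ∈ subst (Vec A) e₂ (xs₂ ++ c ∷ ys₂))
  hole-split refl refl [] a ys₁ [] b ys₂ eq =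
    inj₁ (∷-injectiveˡ eq , λ c → cong (c ∷_) (∷-injectiveʳ eq))
  hole-split refl refl (x ∷ xs₁) a ys₁ [] b ys₂ eq =
    inj₂ λ c → there (subst (a ∈_) (∷-injectiveʳ eq) (∈-++⁺ʳ xs₁ (here refl)))
  hole-split refl refl [] a ys₁ (y ∷ xs₂) b ys₂ eq = inj₂ λ c → here (∷-injectiveˡ eq)
  hole-split refl e₂ (x ∷ xs₁) a ys₁ (y ∷ xs₂) b ys₂ eq
    with eq′ ← trans eq (subst-∷ e₂ (xs₂ ++ b ∷ ys₂))
       | hole-split refl (suc-injective e₂) xs₁ a ys₁ xs₂ b ys₂ (∷-injectiveʳ eq′)
  ... | inj₁ (a≡b , same) =
    inj₁ (a≡b , λ c →
      trans (cong₂ _∷_ (∷-injectiveˡ eq′) (same c)) (sym (subst-∷ e₂ (xs₂ ++ c ∷ ys₂))))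
  ... | inj₂ occurs = inj₂ λ c → subst (a ∈_) (sym (subst-∷ e₂ (xs₂ ++ c ∷ ys₂))) (there (occurs c))

module _ {S : Sig} where

  app-injective : ∀ {T U T′ U′ : BTerm S} → app T U ≡ app T′ U′ → T ≡ T′ × U ≡ U′
  app-injective refl = refl , refl

  lam-injective : ∀ {T T′ : BTerm S} → BTerm.lam T ≡ lam T′ → T ≡ T′
  lam-injective refl = refl

  !-injective : ∀ {T T′ : BTerm S} → ! T ≡ ! T′ → T ≡ T′
  !-injective refl = refl

  op-injective : ∀ {o o′} {Ts : Vec (BTerm S) (ar S o)} {Ts′} → BTerm.op o Ts ≡ op o′ Ts′ →
    Σ (o ≡ o′) λ { refl → Ts ≡ Ts′ }
  op-injective refl = refl , refl

  NonBang : BTerm S → Set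
  NonBang (! _) = ⊥
  NonBang _ = ⊤

  NonVar : BTerm S → Set
  NonVar (var _) = ⊥
  NonVar _ = ⊤

  NonBangᶜ : BCtx S → Set
  NonBangᶜ (bang _) = ⊥
  NonBangᶜ _ = ⊤

  NonLam : Ctx S → Set
  NonLam (lam _) = ⊥
  NonLam _ = ⊤

  funᵛ : BTerm S → BTerm S
  funᵛ (! T) = T
  funᵛ T = app Id T

  funᶜ : BCtx S → BCtx S
  funᶜ (bang C) = C
  funᶜ C = appR Id C

  appᵛ≡app-funᵛ : ∀ T U → appᵛ T U ≡ app (funᵛ T) U
  appᵛ≡app-funᵛ (var x) U = refl
  appᵛ≡app-funᵛ (lam T) U = refl
  appᵛ≡app-funᵛ (app T T′) U = refl
  appᵛ≡app-funᵛ (! T) U = refl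
  appᵛ≡app-funᵛ (op o Ts) U = refl

  appRᵛ≡appR-funᵛ : ∀ T C → appRᵛ T C ≡ appR (funᵛ T) C
  appRᵛ≡appR-funᵛ (var x) C = refl
  appRᵛ≡appR-funᵛ (lam T) C = refl
  appRᵛ≡appR-funᵛ (app T T′) C = refl
  appRᵛ≡appR-funᵛ (! T) C = refl
  appRᵛ≡appR-funᵛ (op o Ts) C = refl

  appLᵛ≡appL-funᶜ : ∀ C T → appLᵛ C T ≡ appL (funᶜ C) T
  appLᵛ≡appL-funᶜ hole T = refl
  appLᵛ≡appL-funᶜ (lam C) T = refl
  appLᵛ≡appL-funᶜ (appL C U) T = refl
  appLᵛ≡appL-funᶜ (appR U C) T = refl
  appLᵛ≡appL-funᶜ (bang C) T = refl
  appLᵛ≡appL-funᶜ (opC o e Ts C Us) T = refl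

  funᵛ-nonBang : ∀ T → NonBang T → funᵛ T ≡ app Id T
  funᵛ-nonBang (var x) _ = refl
  funᵛ-nonBang (lam T) _ = refl
  funᵛ-nonBang (app T T′) _ = refl
  funᵛ-nonBang (op o Ts) _ = refl

  funᶜ-nonBang : ∀ C → NonBangᶜ C → funᶜ C ≡ appR Id C
  funᶜ-nonBang hole _ = refl
  funᶜ-nonBang (lam C) _ = refl
  funᶜ-nonBang (appL C T) _ = refl
  funᶜ-nonBang (appR T C) _ = refl
  funᶜ-nonBang (opC o e Ts C Us) _ = refl

  plug-funᶜ : ∀ C X → NonBang X → bplug (funᶜ C) X ≡ funᵛ (bplug C X)
  plug-funᶜ hole X nb = sym (funᵛ-nonBang X nb)
  plug-funᶜ (lam C) X _ = refl
  plug-funᶜ (appL C T) X _ = refl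
  plug-funᶜ (appR T C) X _ = refl
  plug-funᶜ (bang C) X _ = refl
  plug-funᶜ (opC o e Ts C Us) X _ = refl

  appᵛ-nonBang : ∀ T U → NonBang (appᵛ T U)
  appᵛ-nonBang T U rewrite appᵛ≡app-funᵛ T U = tt

  ᵛ-nonVar : ∀ t → NonVar (t ᵛ)
  ᵛ-nonVar (var x) = tt
  ᵛ-nonVar (lam t) = tt
  ᵛ-nonVar (app t s) rewrite appᵛ≡app-funᵛ (t ᵛ) (s ᵛ) = tt
  ᵛ-nonVar (op o ts) = tt

  ᶜᵛ-nonBang : ∀ c → NonLam c → NonBangᶜ (c ᶜᵛ)
  ᶜᵛ-nonBang hole _ = tt
  ᶜᵛ-nonBang (appL c t) _ rewrite appLᵛ≡appL-funᶜ (c ᶜᵛ) (t ᵛ) = tt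
  ᶜᵛ-nonBang (appR t c) _ rewrite appRᵛ≡appR-funᵛ (t ᵛ) (c ᶜᵛ) = tt
  ᶜᵛ-nonBang (opC o e ts c us) _ = tt

  plug-nonBang⇒nonLam : ∀ c u → NonBang (plug c u ᵛ) → NonLam c
  plug-nonBang⇒nonLam hole u _ = tt
  plug-nonBang⇒nonLam (appL c t) u _ = tt
  plug-nonBang⇒nonLam (appR t c) u _ = tt
  plug-nonBang⇒nonLam (opC o e ts c us) u _ = tt

  Value-ᵛ : ∀ {v : Term S} → Value v → ∃ λ V → v ᵛ ≡ ! V
  Value-ᵛ (var x) = var x , refl
  Value-ᵛ (lam t) = lam (t ᵛ) , refl

  ᵛ≡!⇒Value : ∀ (v : Term S) {V} → v ᵛ ≡ ! V → Value v
  ᵛ≡!⇒Value (var x) _ = var x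
  ᵛ≡!⇒Value (lam t) _ = lam t
  ᵛ≡!⇒Value (app t s) eq = ⊥-elim (subst NonBang eq (appᵛ-nonBang (t ᵛ) (s ᵛ)))

  lev-appLᵛ : ∀ C T → NonBangᶜ C → lev (appLᵛ C T) ≡ lev C
  lev-appLᵛ C T nb rewrite appLᵛ≡appL-funᶜ C T | funᶜ-nonBang C nb = refl

  lev-appRᵛ : ∀ T C → lev (appRᵛ T C) ≡ lev C
  lev-appRᵛ T C rewrite appRᵛ≡appR-funᵛ T C = refl

  mutual
    levᵛ≡lev : (c : Ctx S) → levᵛ c ≡ lev (c ᶜᵛ)
    levᵛ≡lev hole = refl
    levᵛ≡lev (lam c) = cong suc (levᵛ≡lev c)
    levᵛ≡lev (appL (lam c) t) = levᵛ≡lev c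
    levᵛ≡lev (appL hole t) = refl
    levᵛ≡lev (appL (appL c u) t) = levᵛ≡lev-appL (appL c u) t tt
    levᵛ≡lev (appL (appR u c) t) = levᵛ≡lev-appL (appR u c) t tt
    levᵛ≡lev (appL (opC o e ts c us) t) = levᵛ≡lev-appL (opC o e ts c us) t tt
    levᵛ≡lev (appR t c) = trans (levᵛ≡lev c) (sym (lev-appRᵛ (t ᵛ) (c ᶜᵛ)))
    levᵛ≡lev (opC o e ts c us) = cong suc (levᵛ≡lev c)

    levᵛ≡lev-appL : ∀ c t → NonLam c → levᵛ c ≡ lev (appL c t ᶜᵛ)
    levᵛ≡lev-appL c t nl = trans (levᵛ≡lev c) (sym (lev-appLᵛ (c ᶜᵛ) (t ᵛ) (ᶜᵛ-nonBang c nl)))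

  ᵛs-++ : ∀ {n m} (ts : Vec (Term S) n) (us : Vec (Term S) m) → (ts ++ us) ᵛs ≡ (ts ᵛs) ++ (us ᵛs)
  ᵛs-++ [] us = refl
  ᵛs-++ (t ∷ ts) us = cong (t ᵛ ∷_) (ᵛs-++ ts us)

  ᵛs-hole : ∀ {n m N} (e : n + suc m ≡ N) (ts : Vec (Term S) n) t (us : Vec (Term S) m) →
    (subst (Vec (Term S)) e (ts ++ t ∷ us)) ᵛs ≡ subst (Vec (BTerm S)) e ((ts ᵛs) ++ t ᵛ ∷ (us ᵛs))
  ᵛs-hole refl ts t us = ᵛs-++ ts (t ∷ us)

  plug-ᵛ : ∀ c u → NonBang (u ᵛ) → plug c u ᵛ ≡ bplug (c ᶜᵛ) (u ᵛ)
  plug-ᵛ hole u nb = refl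
  plug-ᵛ (lam c) u nb = cong (λ X → ! lam X) (plug-ᵛ c u nb)
  plug-ᵛ (appL c t) u nb = begin
    appᵛ (plug c u ᵛ) (t ᵛ)                    ≡⟨ appᵛ≡app-funᵛ _ (t ᵛ) ⟩
    app (funᵛ (plug c u ᵛ)) (t ᵛ)              ≡⟨ cong (λ X → app (funᵛ X) (t ᵛ)) (plug-ᵛ c u nb) ⟩
    app (funᵛ (bplug (c ᶜᵛ) (u ᵛ))) (t ᵛ)      ≡⟨ cong (λ X → app X (t ᵛ)) (sym (plug-funᶜ (c ᶜᵛ) (u ᵛ) nb)) ⟩
    bplug (appL (funᶜ (c ᶜᵛ)) (t ᵛ)) (u ᵛ)     ≡⟨ cong (λ C → bplug C (u ᵛ)) (sym (appLᵛ≡appL-funᶜ (c ᶜᵛ) (t ᵛ))) ⟩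
    bplug (appLᵛ (c ᶜᵛ) (t ᵛ)) (u ᵛ)           ∎
    where open ≡-Reasoning
  plug-ᵛ (appR t c) u nb = begin
    appᵛ (t ᵛ) (plug c u ᵛ)                    ≡⟨ appᵛ≡app-funᵛ (t ᵛ) _ ⟩
    app (funᵛ (t ᵛ)) (plug c u ᵛ)              ≡⟨ cong (app (funᵛ (t ᵛ))) (plug-ᵛ c u nb) ⟩
    bplug (appR (funᵛ (t ᵛ)) (c ᶜᵛ)) (u ᵛ)     ≡⟨ cong (λ C → bplug C (u ᵛ)) (sym (appRᵛ≡appR-funᵛ (t ᵛ) (c ᶜᵛ))) ⟩
    bplug (appRᵛ (t ᵛ) (c ᶜᵛ)) (u ᵛ)           ∎
    where open ≡-Reasoning
  plug-ᵛ (opC o e ts c us) u nb = cong (op o) (trans (ᵛs-hole e ts (plug c u) us)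
    (cong (λ X → subst (Vec (BTerm S)) e ((ts ᵛs) ++ X ∷ (us ᵛs))) (plug-ᵛ c u nb)))

  -- The administrative 𝖽-step

  _∘ᶜ_ : BCtx S → BCtx S → BCtx S
  hole ∘ᶜ C′ = C′
  lam C ∘ᶜ C′ = lam (C ∘ᶜ C′)
  appL C T ∘ᶜ C′ = appL (C ∘ᶜ C′) T
  appR T C ∘ᶜ C′ = appR T (C ∘ᶜ C′)
  bang C ∘ᶜ C′ = bang (C ∘ᶜ C′)
  opC o e Ts C Us ∘ᶜ C′ = opC o e Ts (C ∘ᶜ C′) Us

  plug-∘ᶜ : ∀ C C′ X → bplug (C ∘ᶜ C′) X ≡ bplug C (bplug C′ X)
  plug-∘ᶜ hole C′ X = refl
  plug-∘ᶜ (lam C) C′ X = cong lam (plug-∘ᶜ C C′ X)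
  plug-∘ᶜ (appL C T) C′ X = cong (λ Y → app Y T) (plug-∘ᶜ C C′ X)
  plug-∘ᶜ (appR T C) C′ X = cong (app T) (plug-∘ᶜ C C′ X)
  plug-∘ᶜ (bang C) C′ X = cong !_ (plug-∘ᶜ C C′ X)
  plug-∘ᶜ (opC o e Ts C Us) C′ X =
    cong (λ Y → op o (subst (Vec (BTerm S)) e (Ts ++ Y ∷ Us))) (plug-∘ᶜ C C′ X)

  lev-∘ᶜ : ∀ C C′ → lev (C ∘ᶜ C′) ≡ lev C + lev C′
  lev-∘ᶜ hole C′ = refl
  lev-∘ᶜ (lam C) C′ = lev-∘ᶜ C C′
  lev-∘ᶜ (appL C T) C′ = lev-∘ᶜ C C′
  lev-∘ᶜ (appR T C) C′ = lev-∘ᶜ C C′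
  lev-∘ᶜ (bang C) C′ = cong suc (lev-∘ᶜ C C′)
  lev-∘ᶜ (opC o e Ts C Us) C′ = cong suc (lev-∘ᶜ C C′)

  StepAt-plug : ∀ {ρ : BTerm S → BTerm S → Set} (C : BCtx S) {k X Y} →
    StepAt ρ k X Y → StepAt ρ (lev C + k) (bplug C X) (bplug C Y)
  StepAt-plug C (C′ , R , R′ , red , refl , refl , refl) =
    C ∘ᶜ C′ , R , R′ , red , sym (plug-∘ᶜ C C′ R) , sym (plug-∘ᶜ C C′ R′) , lev-∘ᶜ C C′

  StepAt⁼-plug : ∀ {ρ : BTerm S → BTerm S → Set} (C : BCtx S) {k X Y} →
    (StepAt ρ k ⁼) X Y → (StepAt ρ (lev C + k) ⁼) (bplug C X) (bplug C Y)
  StepAt⁼-plug C rfl = rfl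
  StepAt⁼-plug C (step s) = step (StepAt-plug C s)

  ≡⇒⁼ : ∀ {ρ : BTerm S → BTerm S → Set} {X Y} → X ≡ Y → (ρ ⁼) X Y
  ≡⇒⁼ refl = rfl

  ⟶𝖽⁼-cast : ∀ {C C′ : BCtx S} {X Y Y′} → C ≡ C′ → Y ≡ Y′ →
    (StepAt 𝖽 (lev C) ⁼) (bplug C X) Y → (StepAt 𝖽 (lev C′) ⁼) (bplug C′ X) Y′
  ⟶𝖽⁼-cast refl refl s = s

  -- The only 𝖽-redex is the administrative Id (! V) created when a value is plugged in function position.
  mutual
    ᶜᵛ-plug-⟶𝖽⁼ : ∀ (c : Ctx S) u → (StepAt 𝖽 (lev (c ᶜᵛ)) ⁼) (bplug (c ᶜᵛ) (u ᵛ)) (plug c u ᵛ)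
    ᶜᵛ-plug-⟶𝖽⁼ hole u = rfl
    ᶜᵛ-plug-⟶𝖽⁼ (lam c) u = StepAt⁼-plug (bang (lam hole)) (ᶜᵛ-plug-⟶𝖽⁼ c u)
    ᶜᵛ-plug-⟶𝖽⁼ (appL c t) u =
      ⟶𝖽⁼-cast (sym (appLᵛ≡appL-funᶜ (c ᶜᵛ) (t ᵛ))) (sym (appᵛ≡app-funᵛ (plug c u ᵛ) (t ᵛ)))
        (StepAt⁼-plug (appL hole (t ᵛ)) (funᶜ-ᶜᵛ-plug-⟶𝖽⁼ c u))
    ᶜᵛ-plug-⟶𝖽⁼ (appR t c) u =
      ⟶𝖽⁼-cast (sym (appRᵛ≡appR-funᵛ (t ᵛ) (c ᶜᵛ))) (sym (appᵛ≡app-funᵛ (t ᵛ) (plug c u ᵛ)))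
        (StepAt⁼-plug (appR (funᵛ (t ᵛ)) hole) (ᶜᵛ-plug-⟶𝖽⁼ c u))
    ᶜᵛ-plug-⟶𝖽⁼ (opC o e ts c us) u =
      ⟶𝖽⁼-cast {C = opC o e (ts ᵛs) (c ᶜᵛ) (us ᵛs)} refl
        (cong (op o) (sym (ᵛs-hole e ts (plug c u) us)))
        (StepAt⁼-plug (opC o e (ts ᵛs) hole (us ᵛs)) (ᶜᵛ-plug-⟶𝖽⁼ c u))

    funᶜ-ᶜᵛ-plug-⟶𝖽⁼ : ∀ (c : Ctx S) u →
      (StepAt 𝖽 (lev (funᶜ (c ᶜᵛ))) ⁼) (bplug (funᶜ (c ᶜᵛ)) (u ᵛ)) (funᵛ (plug c u ᵛ))
    funᶜ-ᶜᵛ-plug-⟶𝖽⁼ hole (var x) = step (hole , _ , _ , der (var x) , refl , refl , refl)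
    funᶜ-ᶜᵛ-plug-⟶𝖽⁼ hole (lam t) = step (hole , _ , _ , der (lam (t ᵛ)) , refl , refl , refl)
    funᶜ-ᶜᵛ-plug-⟶𝖽⁼ hole (app t s) = ≡⇒⁼ (sym (funᵛ-nonBang _ (appᵛ-nonBang (t ᵛ) (s ᵛ))))
    funᶜ-ᶜᵛ-plug-⟶𝖽⁼ hole (op o ts) = rfl
    funᶜ-ᶜᵛ-plug-⟶𝖽⁼ (lam c) u = StepAt⁼-plug (lam hole) (ᶜᵛ-plug-⟶𝖽⁼ c u)
    funᶜ-ᶜᵛ-plug-⟶𝖽⁼ (appL c t) u =
      funᶜ-ᶜᵛ-plug-⟶𝖽⁼-nonLam (appL c t) u tt (appᵛ-nonBang (plug c u ᵛ) (t ᵛ))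
    funᶜ-ᶜᵛ-plug-⟶𝖽⁼ (appR t c) u =
      funᶜ-ᶜᵛ-plug-⟶𝖽⁼-nonLam (appR t c) u tt (appᵛ-nonBang (t ᵛ) (plug c u ᵛ))
    funᶜ-ᶜᵛ-plug-⟶𝖽⁼ (opC o e ts c us) u = funᶜ-ᶜᵛ-plug-⟶𝖽⁼-nonLam (opC o e ts c us) u tt tt

    funᶜ-ᶜᵛ-plug-⟶𝖽⁼-nonLam : ∀ (c : Ctx S) u → NonLam c → NonBang (plug c u ᵛ) →
      (StepAt 𝖽 (lev (funᶜ (c ᶜᵛ))) ⁼) (bplug (funᶜ (c ᶜᵛ)) (u ᵛ)) (funᵛ (plug c u ᵛ))
    funᶜ-ᶜᵛ-plug-⟶𝖽⁼-nonLam c u nl nb =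
      ⟶𝖽⁼-cast (sym (funᶜ-nonBang (c ᶜᵛ) (ᶜᵛ-nonBang c nl))) (sym (funᵛ-nonBang _ nb))
        (StepAt⁼-plug (appR Id hole) (ᶜᵛ-plug-⟶𝖽⁼ c u))

  -- Substitution

  bren-appᵛ : ∀ ρ (T U : BTerm S) → bren ρ (appᵛ T U) ≡ appᵛ (bren ρ T) (bren ρ U)
  bren-appᵛ ρ (var x) U = refl
  bren-appᵛ ρ (lam T) U = refl
  bren-appᵛ ρ (app T T′) U = refl
  bren-appᵛ ρ (! T) U = refl
  bren-appᵛ ρ (op o Ts) U = refl

  mutual
    ren-ᵛ : ∀ ρ (t : Term S) → ren ρ t ᵛ ≡ bren ρ (t ᵛ)
    ren-ᵛ ρ (var x) = refl
    ren-ᵛ ρ (lam t) = cong (λ T → ! lam T) (ren-ᵛ (ext {S} ρ) t)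
    ren-ᵛ ρ (app t s) = trans (cong₂ appᵛ (ren-ᵛ ρ t) (ren-ᵛ ρ s)) (sym (bren-appᵛ ρ (t ᵛ) (s ᵛ)))
    ren-ᵛ ρ (op o ts) = cong (op o) (renV-ᵛs ρ ts)

    renV-ᵛs : ∀ {n} ρ (ts : Vec (Term S) n) → renV ρ ts ᵛs ≡ brenV ρ (ts ᵛs)
    renV-ᵛs ρ [] = refl
    renV-ᵛs ρ (t ∷ ts) = cong₂ _∷_ (ren-ᵛ ρ t) (renV-ᵛs ρ ts)

  -- NonVar is needed: substituting a bang term for a variable changes how appᵛ treats it.
  bsub-appᵛ : ∀ σ (T U : BTerm S) → NonVar T → bsub σ (appᵛ T U) ≡ appᵛ (bsub σ T) (bsub σ U)
  bsub-appᵛ σ (lam T) U _ = refl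
  bsub-appᵛ σ (app T T′) U _ = refl
  bsub-appᵛ σ (! T) U _ = refl
  bsub-appᵛ σ (op o Ts) U _ = refl

  _ᵛ≗!_ : (ℕ → Term S) → (ℕ → BTerm S) → Set
  σ ᵛ≗! σ′ = ∀ x → σ x ᵛ ≡ ! σ′ x

  exts-ᵛ≗! : ∀ {σ σ′} → σ ᵛ≗! σ′ → exts σ ᵛ≗! bexts σ′
  exts-ᵛ≗! eq zero = refl
  exts-ᵛ≗! {σ} eq (suc x) = trans (ren-ᵛ suc (σ x)) (cong (bren suc) (eq x))

  mutual
    sub-ᵛ : ∀ {σ σ′} → σ ᵛ≗! σ′ → (t : Term S) → sub σ t ᵛ ≡ bsub σ′ (t ᵛ)
    sub-ᵛ eq (var x) = eq x
    sub-ᵛ eq (lam t) = cong (λ T → ! lam T) (sub-ᵛ (exts-ᵛ≗! eq) t)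
    sub-ᵛ {σ′ = σ′} eq (app t s) =
      trans (cong₂ appᵛ (sub-ᵛ eq t) (sub-ᵛ eq s)) (sym (bsub-appᵛ σ′ (t ᵛ) (s ᵛ) (ᵛ-nonVar t)))
    sub-ᵛ eq (op o ts) = cong (op o) (subV-ᵛs eq ts)

    subV-ᵛs : ∀ {n σ σ′} → σ ᵛ≗! σ′ → (ts : Vec (Term S) n) → subV σ ts ᵛs ≡ bsubV σ′ (ts ᵛs)
    subV-ᵛs eq [] = refl
    subV-ᵛs eq (t ∷ ts) = cong₂ _∷_ (sub-ᵛ eq t) (subV-ᵛs eq ts)

  []-ᵛ : ∀ (t v : Term S) {V} → v ᵛ ≡ ! V → (t [ v ]) ᵛ ≡ (t ᵛ) ⟦ V ⟧
  []-ᵛ t v {V} eq = sub-ᵛ single-ᵛ≗! t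
    where
      single-ᵛ≗! : single v ᵛ≗! bsingle V
      single-ᵛ≗! zero = eq
      single-ᵛ≗! (suc x) = refl

  -- Inverting the translation

  mutual
    unᵛ : BTerm S → Term S
    unᵛ (var x) = var x
    unᵛ (lam T) = lam (unᵛ T)
    unᵛ (app T U) = unᵛ-app T (unᵛ U)
    unᵛ (! T) = unᵛ T
    unᵛ (op o Ts) = op o (unᵛs Ts)

    unᵛ-app : BTerm S → Term S → Term S
    unᵛ-app (lam (var zero)) u = u
    unᵛ-app T u = app (unᵛ T) u

    unᵛs : ∀ {n} → Vec (BTerm S) n → Vec (Term S) n
    unᵛs [] = []
    unᵛs (T ∷ Ts) = unᵛ T ∷ unᵛs Ts

  unᵛ-app-lam : ∀ T u → NonVar T → unᵛ-app (lam T) u ≡ app (lam (unᵛ T)) u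
  unᵛ-app-lam (var (suc x)) u _ = refl
  unᵛ-app-lam (lam T) u _ = refl
  unᵛ-app-lam (app T T′) u _ = refl
  unᵛ-app-lam (! T) u _ = refl
  unᵛ-app-lam (op o Ts) u _ = refl

  mutual
    unᵛ-app-funᵛ : ∀ (t : Term S) u → unᵛ-app (funᵛ (t ᵛ)) u ≡ app t u
    unᵛ-app-funᵛ (var x) u = refl
    unᵛ-app-funᵛ (lam t) u =
      trans (unᵛ-app-lam (t ᵛ) u (ᵛ-nonVar t)) (cong (λ t′ → app (lam t′) u) (unᵛ-ᵛ t))
    unᵛ-app-funᵛ (app t s) u =
      trans (cong (λ F → unᵛ-app F u) (funᵛ-nonBang _ (appᵛ-nonBang (t ᵛ) (s ᵛ))))
        (cong (λ t′ → app t′ u) (unᵛ-ᵛ (app t s)))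
    unᵛ-app-funᵛ (op o ts) u = cong (λ ts′ → app (op o ts′) u) (unᵛs-ᵛs ts)

    unᵛ-ᵛ : ∀ (t : Term S) → unᵛ (t ᵛ) ≡ t
    unᵛ-ᵛ (var x) = refl
    unᵛ-ᵛ (lam t) = cong lam (unᵛ-ᵛ t)
    unᵛ-ᵛ (app t s) = begin
      unᵛ (appᵛ (t ᵛ) (s ᵛ))            ≡⟨ cong unᵛ (appᵛ≡app-funᵛ (t ᵛ) (s ᵛ)) ⟩
      unᵛ-app (funᵛ (t ᵛ)) (unᵛ (s ᵛ))  ≡⟨ unᵛ-app-funᵛ t (unᵛ (s ᵛ)) ⟩
      app t (unᵛ (s ᵛ))                 ≡⟨ cong (app t) (unᵛ-ᵛ s) ⟩
      app t s                           ∎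
      where open ≡-Reasoning
    unᵛ-ᵛ (op o ts) = cong (op o) (unᵛs-ᵛs ts)

    unᵛs-ᵛs : ∀ {n} (ts : Vec (Term S) n) → unᵛs (ts ᵛs) ≡ ts
    unᵛs-ᵛs [] = refl
    unᵛs-ᵛs (t ∷ ts) = cong₂ _∷_ (unᵛ-ᵛ t) (unᵛs-ᵛs ts)

  ᵛ-injective : ∀ {t s : Term S} → t ᵛ ≡ s ᵛ → t ≡ s
  ᵛ-injective {t} {s} eq = trans (sym (unᵛ-ᵛ t)) (trans (cong unᵛ eq) (unᵛ-ᵛ s))

  data RedexShape : BTerm S → Set where
    β-shape  : ∀ T U → RedexShape (app (lam T) (! U))
    op-shape : ∀ o Ts → RedexShape (op o Ts)

  shape⇒nonBang : ∀ {D} → RedexShape D → NonBang D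
  shape⇒nonBang (β-shape T U) = tt
  shape⇒nonBang (op-shape o Ts) = tt

  shape≢lam : ∀ {D T} → RedexShape D → D ≢ lam T
  shape≢lam (β-shape T U) ()
  shape≢lam (op-shape o Ts) ()

  shape≢Id· : ∀ {D T} → RedexShape D → NonBang T → D ≢ app Id T
  shape≢Id· (β-shape T U) nb refl = nb
  shape≢Id· (op-shape o Ts) nb ()

  plug-shape≢var : ∀ C {D x} → RedexShape D → bplug C D ≢ var x
  plug-shape≢var hole (β-shape T U) ()
  plug-shape≢var hole (op-shape o Ts) ()
  plug-shape≢var (lam C) s ()
  plug-shape≢var (appL C T) s ()
  plug-shape≢var (appR T C) s ()
  plug-shape≢var (bang C) s ()
  plug-shape≢var (opC o e Ts C Us) s ()

  plug-shape≢Id : ∀ C {D} → RedexShape D → bplug C D ≢ Id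
  plug-shape≢Id hole (β-shape T U) ()
  plug-shape≢Id hole (op-shape o Ts) ()
  plug-shape≢Id (lam C) s eq = plug-shape≢var C s (lam-injective eq)
  plug-shape≢Id (appL C T) s ()
  plug-shape≢Id (appR T C) s ()
  plug-shape≢Id (bang C) s ()
  plug-shape≢Id (opC o e Ts C Us) s ()

  Decomposition : Term S → BCtx S → BTerm S → Set
  Decomposition t C D = Σ[ c ∈ Ctx S ] Σ[ u ∈ Term S ] (C ≡ c ᶜᵛ × t ≡ plug c u × u ᵛ ≡ D)

  FunDecomposition : Term S → BCtx S → BTerm S → Set
  FunDecomposition t C D = Σ[ c ∈ Ctx S ] Σ[ u ∈ Term S ] (C ≡ funᶜ (c ᶜᵛ) × t ≡ plug c u × u ᵛ ≡ D)

  -- RedexShape rules out the bangs and Id's that the translation itself introduces.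
  mutual
    ᵛ-decompose : ∀ t C {D} → RedexShape D → t ᵛ ≡ bplug C D → Decomposition t C D
    ᵛ-decompose t hole s eq = hole , t , refl , refl , eq
    ᵛ-decompose (var x) (bang C) s eq = ⊥-elim (plug-shape≢var C s (sym (!-injective eq)))
    ᵛ-decompose (var x) (lam C) s ()
    ᵛ-decompose (var x) (appL C T) s ()
    ᵛ-decompose (var x) (appR T C) s ()
    ᵛ-decompose (var x) (opC o e Ts C Us) s ()
    ᵛ-decompose (lam t) (bang hole) s eq = ⊥-elim (shape≢lam s (sym (!-injective eq)))
    ᵛ-decompose (lam t) (bang (lam C)) s eq with ᵛ-decompose t C s (lam-injective (!-injective eq))
    ... | c , u , refl , refl , eu = lam c , u , refl , refl , eu
    ᵛ-decompose (lam t) (bang (appL C T)) s ()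
    ᵛ-decompose (lam t) (bang (appR T C)) s ()
    ᵛ-decompose (lam t) (bang (bang C)) s ()
    ᵛ-decompose (lam t) (bang (opC o e Ts C Us)) s ()
    ᵛ-decompose (lam t) (lam C) s ()
    ᵛ-decompose (lam t) (appL C T) s ()
    ᵛ-decompose (lam t) (appR T C) s ()
    ᵛ-decompose (lam t) (opC o e Ts C Us) s ()
    ᵛ-decompose (app t₁ t₂) C s eq =
      ᵛ-decompose-app t₁ t₂ C s (trans (sym (appᵛ≡app-funᵛ (t₁ ᵛ) (t₂ ᵛ))) eq)
    ᵛ-decompose (op o ts) (opC o′ e Ts C Us) s eq with op-injective eq
    ... | refl , eq′ with ᵛs-decompose e ts Ts C Us s eq′
    ... | as , _ , bs , refl , refl , refl , c , u , refl , refl , eu = opC o e as c bs , u , refl , refl , eu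
    ᵛ-decompose (op o ts) (lam C) s ()
    ᵛ-decompose (op o ts) (appL C T) s ()
    ᵛ-decompose (op o ts) (appR T C) s ()
    ᵛ-decompose (op o ts) (bang C) s ()

    ᵛ-decompose-app : ∀ t₁ t₂ C {D} → RedexShape D → app (funᵛ (t₁ ᵛ)) (t₂ ᵛ) ≡ bplug C D →
      Decomposition (app t₁ t₂) C D
    ᵛ-decompose-app t₁ t₂ hole s eq = hole , app t₁ t₂ , refl , refl , trans (appᵛ≡app-funᵛ _ _) eq
    ᵛ-decompose-app t₁ t₂ (appL C T) s eq with app-injective eq
    ... | eq₁ , refl with ᵛ-decompose-fun t₁ C s eq₁
    ... | c , u , refl , refl , eu = appL c t₂ , u , sym (appLᵛ≡appL-funᶜ (c ᶜᵛ) (t₂ ᵛ)) , refl , eu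
    ᵛ-decompose-app t₁ t₂ (appR T C) s eq with app-injective eq
    ... | refl , eq₂ with ᵛ-decompose t₂ C s eq₂
    ... | c , u , refl , refl , eu = appR t₁ c , u , sym (appRᵛ≡appR-funᵛ (t₁ ᵛ) (c ᶜᵛ)) , refl , eu
    ᵛ-decompose-app t₁ t₂ (lam C) s ()
    ᵛ-decompose-app t₁ t₂ (bang C) s ()
    ᵛ-decompose-app t₁ t₂ (opC o e Ts C Us) s ()

    ᵛ-decompose-fun : ∀ t C {D} → RedexShape D → funᵛ (t ᵛ) ≡ bplug C D → FunDecomposition t C D
    ᵛ-decompose-fun (var x) C s eq = ⊥-elim (plug-shape≢var C s (sym eq))
    ᵛ-decompose-fun (lam t) hole s eq = ⊥-elim (shape≢lam s (sym eq))
    ᵛ-decompose-fun (lam t) (lam C) s eq with ᵛ-decompose t C s (lam-injective eq)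
    ... | c , u , refl , refl , eu = lam c , u , refl , refl , eu
    ᵛ-decompose-fun (lam t) (appL C T) s ()
    ᵛ-decompose-fun (lam t) (appR T C) s ()
    ᵛ-decompose-fun (lam t) (bang C) s ()
    ᵛ-decompose-fun (lam t) (opC o e Ts C Us) s ()
    ᵛ-decompose-fun (app t₁ t₂) C s eq =
      ᵛ-decompose-Id (app t₁ t₂) nb C s (trans (sym (funᵛ-nonBang _ nb)) eq)
      where nb = appᵛ-nonBang (t₁ ᵛ) (t₂ ᵛ)
    ᵛ-decompose-fun (op o ts) C s eq = ᵛ-decompose-Id (op o ts) tt C s eq

    ᵛ-decompose-Id : ∀ t → NonBang (t ᵛ) → ∀ C {D} → RedexShape D → app Id (t ᵛ) ≡ bplug C D →
      FunDecomposition t C D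
    ᵛ-decompose-Id t nb hole s eq = ⊥-elim (shape≢Id· s nb (sym eq))
    ᵛ-decompose-Id t nb (appL C T) s eq = ⊥-elim (plug-shape≢Id C s (sym (proj₁ (app-injective eq))))
    ᵛ-decompose-Id t nb (appR T C) s eq with app-injective eq
    ... | refl , eq₂ with ᵛ-decompose t C s eq₂
    ... | c , u , refl , refl , eu =
      c , u , sym (funᶜ-nonBang (c ᶜᵛ) (ᶜᵛ-nonBang c (plug-nonBang⇒nonLam c u nb))) , refl , eu
    ᵛ-decompose-Id t nb (lam C) s ()
    ᵛ-decompose-Id t nb (bang C) s ()
    ᵛ-decompose-Id t nb (opC o e Ts C Us) s ()

    ᵛs-decompose : ∀ {n m N} (e : n + suc m ≡ N) (ts : Vec (Term S) N) Ts C (Us : Vec (BTerm S) m) {D} →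
      RedexShape D → ts ᵛs ≡ subst (Vec (BTerm S)) e (Ts ++ bplug C D ∷ Us) →
      Σ[ as ∈ Vec (Term S) n ] Σ[ t ∈ Term S ] Σ[ bs ∈ Vec (Term S) m ]
        (ts ≡ subst (Vec (Term S)) e (as ++ t ∷ bs) × as ᵛs ≡ Ts × bs ᵛs ≡ Us × Decomposition t C D)
    ᵛs-decompose refl (t ∷ ts) [] C Us s eq =
      [] , t , ts , refl , refl , ∷-injectiveʳ eq , ᵛ-decompose t C s (∷-injectiveˡ eq)
    ᵛs-decompose refl (t ∷ ts) (T ∷ Ts) C Us s eq with ᵛs-decompose refl ts Ts C Us s (∷-injectiveʳ eq)
    ... | as , t′ , bs , refl , refl , refl , d =
      t ∷ as , t′ , bs , refl , cong (_∷ (as ᵛs)) (∷-injectiveˡ eq) , refl , d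

  ᵛ-funᵛ≡lam : ∀ t {T} → funᵛ (t ᵛ) ≡ lam T → ∃ λ a → t ≡ lam a × a ᵛ ≡ T
  ᵛ-funᵛ≡lam (lam a) eq = a , refl , lam-injective eq
  ᵛ-funᵛ≡lam (app t s) eq with trans (sym (funᵛ-nonBang _ (appᵛ-nonBang (t ᵛ) (s ᵛ)))) eq
  ... | ()

  ᵛ≡β-redex : ∀ u {T U} → u ᵛ ≡ app (lam T) (! U) →
    Σ[ t ∈ Term S ] Σ[ v ∈ Term S ] (u ≡ app (lam t) v × t ᵛ ≡ T × v ᵛ ≡ ! U)
  ᵛ≡β-redex (app t₁ t₂) eq with app-injective (trans (sym (appᵛ≡app-funᵛ (t₁ ᵛ) (t₂ ᵛ))) eq)
  ... | eq₁ , eq₂ with ᵛ-funᵛ≡lam t₁ eq₁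
  ... | a , refl , ea = a , t₂ , refl , ea , eq₂

  -- 𝖽-normal forms

  𝖽-redex : BTerm S → BTerm S
  𝖽-redex T = app Id (! T)

  Has𝖽Redex : BTerm S → Set
  Has𝖽Redex M = Σ[ C ∈ BCtx S ] Σ[ T ∈ BTerm S ] M ≡ bplug C (𝖽-redex T)

  ᵛ-𝖽-normal : ∀ t → ¬ Has𝖽Redex (t ᵛ)
  ᵛ-𝖽-normal t (C , T , eq) with ᵛ-decompose t C (β-shape (var zero) T) eq
  ... | c , u , _ , _ , eu with ᵛ≡β-redex u eu
  ... | a , _ , _ , ea , _ = subst NonVar ea (ᵛ-nonVar a)

  Has𝖽Redex-plug : ∀ C {M} → Has𝖽Redex M → Has𝖽Redex (bplug C M)
  Has𝖽Redex-plug C (C′ , T , refl) = C ∘ᶜ C′ , T , sym (plug-∘ᶜ C C′ (𝖽-redex T))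

  -- 𝖽-redexes never overlap: contracting one of two distinct ones leaves the other in place.
  𝖽-redex-overlap : ∀ C₁ T₁ C₂ T₂ → bplug C₁ (𝖽-redex T₁) ≡ bplug C₂ (𝖽-redex T₂) →
    bplug C₁ T₁ ≡ bplug C₂ T₂ ⊎ Has𝖽Redex (bplug C₂ T₂)
  𝖽-redex-overlap hole T₁ hole T₂ refl = inj₁ refl
  𝖽-redex-overlap hole T₁ (appR U (bang C₂)) T₂ refl = inj₂ (hole , bplug C₂ T₂ , refl)
  𝖽-redex-overlap hole T₁ (appR U hole) T₂ ()
  𝖽-redex-overlap hole T₁ (appR U (lam C₂)) T₂ ()
  𝖽-redex-overlap hole T₁ (appR U (appL C₂ V)) T₂ ()
  𝖽-redex-overlap hole T₁ (appR U (appR V C₂)) T₂ ()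
  𝖽-redex-overlap hole T₁ (appR U (opC o e Ts C₂ Us)) T₂ ()
  𝖽-redex-overlap hole T₁ (appL C₂ U) T₂ eq =
    ⊥-elim (plug-shape≢Id C₂ (β-shape (var zero) T₂) (sym (proj₁ (app-injective eq))))
  𝖽-redex-overlap hole T₁ (lam C₂) T₂ ()
  𝖽-redex-overlap hole T₁ (bang C₂) T₂ ()
  𝖽-redex-overlap hole T₁ (opC o e Ts C₂ Us) T₂ ()
  𝖽-redex-overlap (lam C₁) T₁ (lam C₂) T₂ eq =
    Sum.map (cong lam) (Has𝖽Redex-plug (lam hole)) (𝖽-redex-overlap C₁ T₁ C₂ T₂ (lam-injective eq))
  𝖽-redex-overlap (lam C₁) T₁ hole T₂ ()
  𝖽-redex-overlap (lam C₁) T₁ (appL C₂ U) T₂ ()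
  𝖽-redex-overlap (lam C₁) T₁ (appR U C₂) T₂ ()
  𝖽-redex-overlap (lam C₁) T₁ (bang C₂) T₂ ()
  𝖽-redex-overlap (lam C₁) T₁ (opC o e Ts C₂ Us) T₂ ()
  𝖽-redex-overlap (appL C₁ U) T₁ hole T₂ eq =
    ⊥-elim (plug-shape≢Id C₁ (β-shape (var zero) T₁) (proj₁ (app-injective eq)))
  𝖽-redex-overlap (appL C₁ U) T₁ (appL C₂ U′) T₂ eq with app-injective eq
  ... | eq₁ , refl =
    Sum.map (cong (λ X → app X U)) (Has𝖽Redex-plug (appL hole U)) (𝖽-redex-overlap C₁ T₁ C₂ T₂ eq₁)
  𝖽-redex-overlap (appL C₁ U) T₁ (appR V C₂) T₂ eq with app-injective eq
  ... | refl , refl = inj₂ (appL C₁ (bplug C₂ T₂) , T₁ , refl)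
  𝖽-redex-overlap (appL C₁ U) T₁ (lam C₂) T₂ ()
  𝖽-redex-overlap (appL C₁ U) T₁ (bang C₂) T₂ ()
  𝖽-redex-overlap (appL C₁ U) T₁ (opC o e Ts C₂ Us) T₂ ()
  𝖽-redex-overlap (appR V (bang C₁)) T₁ hole T₂ refl = inj₂ (C₁ , T₁ , refl)
  𝖽-redex-overlap (appR V hole) T₁ hole T₂ ()
  𝖽-redex-overlap (appR V (lam C₁)) T₁ hole T₂ ()
  𝖽-redex-overlap (appR V (appL C₁ U)) T₁ hole T₂ ()
  𝖽-redex-overlap (appR V (appR U C₁)) T₁ hole T₂ ()
  𝖽-redex-overlap (appR V (opC o e Ts C₁ Us)) T₁ hole T₂ ()
  𝖽-redex-overlap (appR V C₁) T₁ (appL C₂ U) T₂ eq with app-injective eq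
  ... | refl , refl = inj₂ (appR (bplug C₂ T₂) C₁ , T₁ , refl)
  𝖽-redex-overlap (appR V C₁) T₁ (appR V′ C₂) T₂ eq with app-injective eq
  ... | refl , eq₂ =
    Sum.map (cong (app V)) (Has𝖽Redex-plug (appR V hole)) (𝖽-redex-overlap C₁ T₁ C₂ T₂ eq₂)
  𝖽-redex-overlap (appR V C₁) T₁ (lam C₂) T₂ ()
  𝖽-redex-overlap (appR V C₁) T₁ (bang C₂) T₂ ()
  𝖽-redex-overlap (appR V C₁) T₁ (opC o e Ts C₂ Us) T₂ ()
  𝖽-redex-overlap (bang C₁) T₁ (bang C₂) T₂ eq =
    Sum.map (cong !_) (Has𝖽Redex-plug (bang hole)) (𝖽-redex-overlap C₁ T₁ C₂ T₂ (!-injective eq))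
  𝖽-redex-overlap (bang C₁) T₁ hole T₂ ()
  𝖽-redex-overlap (bang C₁) T₁ (lam C₂) T₂ ()
  𝖽-redex-overlap (bang C₁) T₁ (appL C₂ U) T₂ ()
  𝖽-redex-overlap (bang C₁) T₁ (appR U C₂) T₂ ()
  𝖽-redex-overlap (bang C₁) T₁ (opC o e Ts C₂ Us) T₂ ()
  𝖽-redex-overlap (opC o e₁ Ts₁ C₁ Us₁) T₁ (opC o′ e₂ Ts₂ C₂ Us₂) T₂ eq with op-injective eq
  ... | refl , eq′ with hole-split e₁ e₂ Ts₁ _ Us₁ Ts₂ _ Us₂ eq′
  ... | inj₁ (eq″ , same) =
    Sum.map (λ eqT → cong (op o) (trans (same _)
              (cong (λ X → subst (Vec (BTerm S)) e₂ (Ts₂ ++ X ∷ Us₂)) eqT)))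
      (Has𝖽Redex-plug (opC o e₂ Ts₂ hole Us₂)) (𝖽-redex-overlap C₁ T₁ C₂ T₂ eq″)
  ... | inj₂ occurs with ∈⇒hole (occurs (bplug C₂ T₂))
  ... | _ , _ , e , xs , ys , eqv = inj₂ (opC o e xs C₁ ys , T₁ , cong (op o) eqv)
  𝖽-redex-overlap (opC o e Ts C₁ Us) T₁ hole T₂ ()
  𝖽-redex-overlap (opC o e Ts C₁ Us) T₁ (lam C₂) T₂ ()
  𝖽-redex-overlap (opC o e Ts C₁ Us) T₁ (appL C₂ U) T₂ ()
  𝖽-redex-overlap (opC o e Ts C₁ Us) T₁ (appR U C₂) T₂ ()
  𝖽-redex-overlap (opC o e Ts C₁ Us) T₁ (bang C₂) T₂ ()

  ⟶𝖽⁼-normal-unique : ∀ {k k′} {M N N′ : BTerm S} → ¬ Has𝖽Redex N → ¬ Has𝖽Redex N′ →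
    (StepAt 𝖽 k ⁼) M N → (StepAt 𝖽 k′ ⁼) M N′ → N ≡ N′
  ⟶𝖽⁼-normal-unique nf nf′ rfl rfl = refl
  ⟶𝖽⁼-normal-unique nf nf′ rfl (step (C , _ , _ , der T , refl , _ , _)) = ⊥-elim (nf (C , T , refl))
  ⟶𝖽⁼-normal-unique nf nf′ (step (C , _ , _ , der T , refl , _ , _)) rfl = ⊥-elim (nf′ (C , T , refl))
  ⟶𝖽⁼-normal-unique nf nf′ (step (C₁ , _ , _ , der T₁ , refl , refl , _))
                           (step (C₂ , _ , _ , der T₂ , eq , refl , _))
    with 𝖽-redex-overlap C₁ T₁ C₂ T₂ eq
  ... | inj₁ eq′ = eq′
  ... | inj₂ has = ⊥-elim (nf′ has)

  ᶜᵛ-plug-⟶𝖽⁼-unique : ∀ c u s {k} → (StepAt 𝖽 k ⁼) (bplug (c ᶜᵛ) (u ᵛ)) (s ᵛ) → s ≡ plug c u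
  ᶜᵛ-plug-⟶𝖽⁼-unique c u s st =
    ᵛ-injective (⟶𝖽⁼-normal-unique (ᵛ-𝖽-normal s) (ᵛ-𝖽-normal (plug c u)) st (ᶜᵛ-plug-⟶𝖽⁼ c u))

  -- Simulation of steps and redex positions

  StepAtᵛ-simulation : ∀ {ρ : Term S → Term S → Set} {ρ′ : BTerm S → BTerm S → Set} →
    (∀ {r r′} → ρ r r′ → ρ′ (r ᵛ) (r′ ᵛ)) → (∀ {D D′} → ρ′ D D′ → RedexShape D) →
    ∀ {k t s} → StepAtᵛ ρ k t s → (StepAt ρ′ k · (StepAt 𝖽 k ⁼)) (t ᵛ) (s ᵛ)
  StepAtᵛ-simulation simulate shape (c , r , r′ , red , refl , refl , refl) =
    bplug (c ᶜᵛ) (r′ ᵛ) ,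
    (c ᶜᵛ , r ᵛ , r′ ᵛ , simulate red , plug-ᵛ c r (shape⇒nonBang (shape (simulate red))) , refl ,
      sym (levᵛ≡lev c)) ,
    subst (λ k → (StepAt 𝖽 k ⁼) (bplug (c ᶜᵛ) (r′ ᵛ)) (plug c r′ ᵛ)) (sym (levᵛ≡lev c))
      (ᶜᵛ-plug-⟶𝖽⁼ c r′)

  StepAtᵛ-reflection : ∀ {ρ : Term S → Term S → Set} {ρ′ : BTerm S → BTerm S → Set} →
    (∀ {D D′} → ρ′ D D′ → RedexShape D) →
    (∀ {u D D′} → ρ′ D D′ → u ᵛ ≡ D → ∃ λ u′ → ρ u u′ × D′ ≡ u′ ᵛ) →
    ∀ {k t s} → (StepAt ρ′ k · (StepAt 𝖽 k ⁼)) (t ᵛ) (s ᵛ) → StepAtᵛ ρ k t s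
  StepAtᵛ-reflection shape reflect {t = t} {s} (_ , (C , D , D′ , red , eq , refl , lv) , st)
    with ᵛ-decompose t C (shape red) eq
  ... | c , u , refl , refl , eu with reflect red eu
  ... | u′ , red′ , refl =
    c , u , u′ , red′ , refl , ᶜᵛ-plug-⟶𝖽⁼-unique c u′ s st , trans (levᵛ≡lev c) lv

  βᵥ⇒!β : ∀ {r r′ : Term S} → βᵥ r r′ → !β (r ᵛ) (r′ ᵛ)
  βᵥ⇒!β (βv t v val) with Value-ᵛ val
  ... | V , eV = subst₂ !β (cong (app (lam (t ᵛ))) (sym eV)) (sym ([]-ᵛ t v eV)) (bβ (t ᵛ) V)

  !β-shape : ∀ {D D′ : BTerm S} → !β D D′ → RedexShape D
  !β-shape (bβ T U) = β-shape T U

  !β⇒βᵥ : ∀ {u : Term S} {D D′} → !β D D′ → u ᵛ ≡ D → ∃ λ u′ → βᵥ u u′ × D′ ≡ u′ ᵛ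
  !β⇒βᵥ {u} (bβ T U) eq with ᵛ≡β-redex u eq
  ... | t , v , refl , refl , eV = t [ v ] , βv t v (ᵛ≡!⇒Value v eV) , sym ([]-ᵛ t v eV)

module _ {S : Sig} (R : ORules {S}) where

  BO-shape : OShaped R → ∀ {o D D′} → BO R o D D′ → RedexShape D
  BO-shape shaped (img r r′ red) with shaped _ r r′ red
  ... | ts , refl = op-shape _ (ts ᵛs)

  BO⇒R : ∀ {o} {u : Term S} {D D′} → BO R o D D′ → u ᵛ ≡ D → ∃ λ u′ → R o u u′ × D′ ≡ u′ ᵛ
  BO⇒R {u = u} (img r r′ red) eq with ᵛ-injective {t = u} {s = r} eq
  ... | refl = r′ , red , refl

  RedexAtᵛ : Term S → ℕ → Set
  RedexAtᵛ t k = Σ[ c ∈ Ctx S ] Σ[ r ∈ Term S ] (RedexΛ R r × t ≡ plug c r × levᵛ c ≡ k)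

  RedexAt : BTerm S → ℕ → Set
  RedexAt T k = Σ[ C ∈ BCtx S ] Σ[ U ∈ BTerm S ] (RedexB R U × T ≡ bplug C U × lev C ≡ k)

  RedexΛ⇒RedexB : ∀ {r} → RedexΛ R r → RedexB R (r ᵛ)
  RedexΛ⇒RedexB (inj₁ (r′ , red)) = inj₁ (r′ ᵛ , βᵥ⇒!β red)
  RedexΛ⇒RedexB (inj₂ (o , r′ , red)) = inj₂ (o , r′ ᵛ , img _ r′ red)

  RedexB-shape : OShaped R → ∀ {D} → RedexB R D → RedexShape D
  RedexB-shape shaped (inj₁ (_ , red)) = !β-shape red
  RedexB-shape shaped (inj₂ (_ , _ , red)) = BO-shape shaped red

  RedexB⇒RedexΛ : ∀ {u D} → RedexB R D → u ᵛ ≡ D → RedexΛ R u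
  RedexB⇒RedexΛ {u} (inj₁ (_ , red)) eq with !β⇒βᵥ {u = u} red eq
  ... | u′ , red′ , _ = inj₁ (u′ , red′)
  RedexB⇒RedexΛ {u} (inj₂ (o , _ , red)) eq with BO⇒R {u = u} red eq
  ... | u′ , red′ , _ = inj₂ (o , u′ , red′)

  RedexAtᵛ⇔RedexAt : OShaped R → ∀ t k → RedexAtᵛ t k ⇔ RedexAt (t ᵛ) k
  RedexAtᵛ⇔RedexAt shaped t k = mk⇔ to from
    where
      to : RedexAtᵛ t k → RedexAt (t ᵛ) k
      to (c , r , red , refl , lv) =
        c ᶜᵛ , r ᵛ , RedexΛ⇒RedexB red ,
        plug-ᵛ c r (shape⇒nonBang (RedexB-shape shaped (RedexΛ⇒RedexB red))) , trans (sym (levᵛ≡lev c)) lv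
      from : RedexAt (t ᵛ) k → RedexAtᵛ t k
      from (C , D , red , eq , lv) with ᵛ-decompose t C (RedexB-shape shaped red) eq
      ... | c , u , refl , refl , eu = c , u , RedexB⇒RedexΛ red eu , refl , trans (levᵛ≡lev c) lv

IsInf-resp : ∀ {A B : ℕ → Set} {x} → (∀ k → B k → A k) → (∀ k → A k → B k) → IsInf A x → IsInf B x
IsInf-resp B⇒A A⇒B (lower , greatest) =
  (λ m b → lower m (B⇒A m b)) , (λ y lowerB → greatest y (λ m a → lowerB m (A⇒B m a)))

IsInf-cong : ∀ {A B : ℕ → Set} {x} → (∀ k → A k ⇔ B k) → IsInf A x ⇔ IsInf B x
IsInf-cong A⇔B = mk⇔ (IsInf-resp (λ k → Equivalence.from (A⇔B k)) (λ k → Equivalence.to (A⇔B k)))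
                     (IsInf-resp (λ k → Equivalence.to (A⇔B k)) (λ k → Equivalence.from (A⇔B k)))

lemma5 : (S : Sig) (R : ORules {S}) → OShaped R →
    ((c : Ctx S) → levᵛ c ≡ lev (c ᶜᵛ))
    × ((t s : Term S) (k : ℕ) →
         (StepAtᵛ βᵥ k t s ⇔ (StepAt !β k · (StepAt 𝖽 k ⁼)) (t ᵛ) (s ᵛ))
         × ((o : O S) → StepAtᵛ (R o) k t s ⇔ (StepAt (BO R o) k · (StepAt 𝖽 k ⁼)) (t ᵛ) (s ᵛ)))
    × ((t : Term S) (x : ℕ∞) → llᵛ≡ R t x ⇔ ll≡ R (t ᵛ) x)
lemma5 S R shaped =
  levᵛ≡lev ,
  (λ t s k →
    mk⇔ (StepAtᵛ-simulation βᵥ⇒!β !β-shape) (StepAtᵛ-reflection !β-shape !β⇒βᵥ) ,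
    λ o → mk⇔ (StepAtᵛ-simulation (img _ _) (BO-shape R shaped))
              (StepAtᵛ-reflection (BO-shape R shaped) (BO⇒R R))) ,
  (λ t x → IsInf-cong (RedexAtᵛ⇔RedexAt R shaped t))
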